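{- Let $k\ge 1$, let $A=\{a_0,a_1,\ldots,a_{k-1}\}$ be a set of integers with $a_0<a_1<\cdots<a_{k-1}$, let $\mathbf{r}=(r_0,r_1,\ldots,r_{k-1})$ be an ordered $k$-tuple of positive integers, and let $h$ be an integer with $2\le h\le \sum_{j=0}^{k-1} r_j$. Then $$|h^{(\mathbf{r})}A|\ge L(\mathbf{r},h).$$ Moreover, this lower bound is best possible: for every such $\mathbf{r}$ and $h$ there exists a set $A$ of $k$ integers (for instance $A=\{0,1,\ldots,k-1\}$) with $|h^{(\mathbf{r})}A|=L(\mathbf{r},h)$.
   Context: For a set $A=\{a_0,\ldots,a_{k-1}\}$ of integers, a $k$-tuple $\mathbf{r}=(r_0,\ldots,r_{k-1})$ of positive integers and a positive integer $h$, define the general $h$-fold sumset $$h^{(\mathbf{r})}A=\Big\{\sum_{i=0}^{k-1}s_ia_i:\ s_i\in\mathbb{Z},\ 0\le s_i\le r_i\ (0\le i\le k-1),\ \sum_{i=0}^{k-1}s_i=h\Big\}.$$ Empty sums are $0$. Let $I_{\mathbf{r}}(h)$ be the largest integer (with $0\le I_{\mathbf{r}}(h)\le k$) such that $\sum_{j=0}^{I_{\mathbf{r}}(h)-1}r_j\le h$, and $M_{\mathbf{r}}(h)$ the least integer (with $-1\le M_{\mathbf{r}}(h)\le k-1$) such that $\sum_{j=M_{\mathbf{r}}(h)+1}^{k-1}r_j\le h$. Put $\delta_{\mathbf{r}}(h)=h-\sum_{j=0}^{I_{\mathbf{r}}(h)-1}r_j$ and $\theta_{\mathbf{r}}(h)=h-\sum_{j=M_{\mathbf{r}}(h)+1}^{k-1}r_j$,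 and $$L(\mathbf{r},h)=\sum_{j=M_{\mathbf{r}}(h)+1}^{k-1}j r_j-\sum_{j=0}^{I_{\mathbf{r}}(h)-1}j r_j+M_{\mathbf{r}}(h)\,\theta_{\mathbf{r}}(h)-I_{\mathbf{r}}(h)\,\delta_{\mathbf{r}}(h)+1.$$ -}

module Defs where

open import Data.Nat as ℕ using (ℕ; zero; suc; _<?_; _≤?_)
open import Data.Fin as Fin using (Fin; fromℕ<)
open import Data.Integer as ℤ using (ℤ; +_)
open import Data.List using (List; []; _∷_; length; upTo)
open import Data.List.Membership.Propositional using (_∈_)
open import Data.List.Relation.Unary.Unique.Propositional using (Unique)
open import Data.Product using (∃; _×_)
open import Function.Bundles using (_⇔_)
open import Relation.Nullary using (yes; no)
open import Relation.Binary.PropositionalEquality using (_≡_)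

ΣF : ∀ {n} → (Fin n → ℕ) → ℕ
ΣF {zero}  f = 0
ΣF {suc n} f = f Fin.zero ℕ.+ ΣF (λ i → f (Fin.suc i))

ΣFℤ : ∀ {n} → (Fin n → ℤ) → ℤ
ΣFℤ {zero}  f = + 0
ΣFℤ {suc n} f = f Fin.zero ℤ.+ ΣFℤ (λ i → f (Fin.suc i))

ext : ∀ {k} → (Fin k → ℕ) → ℕ → ℕ
ext {k} r j with j <? k
... | yes p = r (fromℕ< p)
... | no _  = 0

sumFrom : (ℕ → ℕ) → ℕ → ℕ → ℕ
sumFrom f m zero    = 0
sumFrom f m (suc c) = f m ℕ.+ sumFrom f (suc m) c

-- range f m n = Σ_{j=m}^{n-1} f j  (empty if n ≤ m)
range : (ℕ → ℕ) → ℕ → ℕ → ℕ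
range f m n = sumFrom f m (n ℕ.∸ m)

module _ {k : ℕ} (r : Fin k → ℕ) (h : ℕ) where

  P : ℕ → ℕ
  P m = range (ext r) 0 m

  S : ℕ → ℕ
  S m = range (ext r) m k

  largest : ℕ → ℕ
  largest zero = 0
  largest (suc n) with P (suc n) ≤? h
  ... | yes _ = suc n
  ... | no  _ = largest n

  -- I_r(h): largest integer 0 ≤ I ≤ k with Σ_{j<I} r_j ≤ h
  Ir : ℕ
  Ir = largest k

  firstS : List ℕ → ℕ
  firstS [] = k
  firstS (m ∷ ms) with S m ≤? h
  ... | yes _ = m
  ... | no  _ = firstS ms

  -- M' = M_r(h) + 1: least integer 0 ≤ M' ≤ k with Σ_{j=M'}^{k-1} r_j ≤ h
  M′ : ℕ
  M′ = firstS (upTo (suc k))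

  Mr : ℤ
  Mr = + M′ ℤ.- + 1

  δr : ℤ
  δr = + h ℤ.- + P Ir

  θr : ℤ
  θr = + h ℤ.- + S M′

  jr : ℕ → ℕ
  jr j = j ℕ.* ext r j

  L : ℤ
  L = + range jr M′ k ℤ.- + range jr 0 Ir ℤ.+ Mr ℤ.* θr ℤ.- + Ir ℤ.* δr ℤ.+ + 1

-- x ∈ h^(r) A, with A given by a : Fin k → ℤ
InSumset : ∀ {k} → (Fin k → ℤ) → (Fin k → ℕ) → ℕ → ℤ → Set
InSumset {k} a r h x =
  ∃ λ (s : Fin k → ℕ) → (∀ i → s i ℕ.≤ r i) × ΣF s ≡ h × x ≡ ΣFℤ (λ i → + s i ℤ.* a i)

HasCard : (ℤ → Set) → ℕ → Set
HasCard Q n = ∃ λ (l : List ℤ) → Unique l × (∀ x → (x ∈ l) ⇔ Q x) × length l ≡ n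

StrictlyIncreasing : ∀ {k} → (Fin k → ℤ) → Set
StrictlyIncreasing {k} a = ∀ (i j : Fin k) → i Fin.< j → a i ℤ.< a j

{-# OPTIONS --safe #-}
module Submission where

-- Write an element of h^(r)A as Σ sᵢ aᵢ with 0 ≤ sᵢ ≤ rᵢ and Σ sᵢ = h. Moving one unit of s from
-- coordinate i to i + 1 raises Σ sᵢ aᵢ strictly (A is increasing) and the weight Σ i sᵢ by exactly
-- one. Every admissible s can be reached by such moves from the vector packed as far left as the
-- caps rᵢ allow, and can itself be moved to the vector packed as far right as possible; these two
-- have weights Σ_{j<I} j rⱼ + I δ and Σ_{j>M} j rⱼ + M θ. A chain of moves between them therefore
-- passes through L(r,h) = (difference of the weights) + 1 distinct sums. For A = {0,…,k−1} the sum
-- is the weight itself, so every element of the sumset already lies on that chain.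

open import Defs
open import Data.Fin as Fin using (Fin; fromℕ<; toℕ)
open import Data.Fin.Properties using (fromℕ<-cong)
open import Data.Integer as ℤ using (ℤ; +_; +≤+)
import Data.Integer.Properties as ℤₚ
open import Data.Integer.Tactic.RingSolver using () renaming (solve-∀ to ℤ-solve-∀)
open import Data.List
  using (List; []; _∷_; length; map; filter; deduplicate; upTo; applyUpTo; tabulate; cartesianProductWith)
open import Data.List.Properties using (length-map; length-removeAt′; length-tabulate; tabulate-cong)
open import Data.List.Membership.Propositional using (_∈_; find)
open import Data.List.Membership.Propositional.Properties
  using (∈-map⁺; ∈-map⁻; ∈-filter⁺; ∈-filter⁻; ∈-deduplicate⁺; ∈-deduplicate⁻;
         ∈-upTo⁺; ∈-upTo⁻; ∈-cartesianProductWith⁺; ∈-cartesianProductWith⁻)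
open import Data.List.Relation.Binary.Pointwise using (Pointwise; []; _∷_)
open import Data.List.Relation.Unary.All as All using (All; []; _∷_)
import Data.List.Relation.Unary.All.Properties as Allₚ
open import Data.List.Relation.Unary.Any using (Any; here; there; _─_)
open import Data.List.Relation.Unary.Linked as Linked using (Linked; []; [-]; _∷_)
open import Data.List.Relation.Unary.Unique.Propositional using (Unique; []; _∷_)
open import Data.List.Relation.Unary.Unique.DecPropositional.Properties using (deduplicate-!)
open import Data.Nat as ℕ using (ℕ; zero; suc; _+_; _*_; _∸_; _⊓_; _≤_; _<_; z≤n; s≤s; z<s)
open import Data.Nat.ListAction using (sum)
open import Data.Nat.Properties
open import Data.Nat.Tactic.RingSolver using (solve-∀)
open import Data.Product using (∃; _×_; _,_; proj₁)
open import Data.Vec.Functional using () renaming (_∷_ to cons)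
open import Function using (_∘_)
open import Function.Bundles using (_⇔_; mk⇔; Equivalence)
import Function.Properties.Equivalence as ⇔
open import Level using (0ℓ)
open import Relation.Binary using (Rel)
open import Relation.Binary.Construct.Closure.ReflexiveTransitive using (Star; ε; _◅_; _◅◅_; gmap)
open import Relation.Binary.PropositionalEquality
open import Relation.Nullary using (yes; no; ¬_; contradiction)

-- Arithmetic and finite sums

m+o≤n⇒m⊓[n∸o]≡m : ∀ m n o → m + o ≤ n → m ⊓ (n ∸ o) ≡ m
m+o≤n⇒m⊓[n∸o]≡m m n o m+o≤n = m≤n⇒m⊓n≡m (subst (_≤ n ∸ o) (m+n∸n≡m m o) (∸-monoˡ-≤ o m+o≤n))

n≤m+o⇒m⊓[n∸o]≡n∸o : ∀ m n o → n ≤ m + o → m ⊓ (n ∸ o) ≡ n ∸ o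
n≤m+o⇒m⊓[n∸o]≡n∸o m n o n≤m+o = m≥n⇒m⊓n≡n (subst (n ∸ o ≤_) (m+n∸n≡m m o) (∸-monoˡ-≤ o n≤m+o))

n≤o⇒m⊓[n∸o]≡0 : ∀ m n o → n ≤ o → m ⊓ (n ∸ o) ≡ 0
n≤o⇒m⊓[n∸o]≡0 m n o n≤o = trans (cong (m ⊓_) (m≤n⇒m∸n≡0 n≤o)) (⊓-zeroʳ m)

m+n∸o≡m∸[o∸n] : ∀ m {n o} → n ≤ o → m + n ∸ o ≡ m ∸ (o ∸ n)
m+n∸o≡m∸[o∸n] m {n} {o} n≤o = begin
  m + n ∸ o                ≡⟨ cong (m + n ∸_) (sym (m+[n∸m]≡n n≤o)) ⟩
  m + n ∸ (n + (o ∸ n))    ≡⟨ sym (∸-+-assoc (m + n) n (o ∸ n)) ⟩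
  m + n ∸ n ∸ (o ∸ n)      ≡⟨ cong (_∸ (o ∸ n)) (m+n∸n≡m m n) ⟩
  m ∸ (o ∸ n)              ∎
  where open ≡-Reasoning

sumFrom-suc : ∀ f m n → sumFrom f (suc m) n ≡ sumFrom (f ∘ suc) m n
sumFrom-suc f m zero    = refl
sumFrom-suc f m (suc n) = cong (_+_ (f (suc m))) (sumFrom-suc f (suc m) n)

sumFrom-+ : ∀ f m a b → sumFrom f m (a + b) ≡ sumFrom f m a + sumFrom f (m + a) b
sumFrom-+ f m zero    b = cong (λ i → sumFrom f i b) (sym (+-identityʳ m))
sumFrom-+ f m (suc a) b = begin
  f m + sumFrom f (suc m) (a + b)
    ≡⟨ cong (_+_ (f m)) (sumFrom-+ f (suc m) a b) ⟩
  f m + (sumFrom f (suc m) a + sumFrom f (suc m + a) b)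
    ≡⟨ sym (+-assoc (f m) _ _) ⟩
  f m + sumFrom f (suc m) a + sumFrom f (suc m + a) b
    ≡⟨ cong (λ i → f m + sumFrom f (suc m) a + sumFrom f i b) (sym (+-suc m a)) ⟩
  f m + sumFrom f (suc m) a + sumFrom f (m + suc a) b
    ∎
  where open ≡-Reasoning

sumFrom-cong : ∀ {f g} m n → (∀ j → m ≤ j → j < m + n → f j ≡ g j) → sumFrom f m n ≡ sumFrom g m n
sumFrom-cong m zero    eq = refl
sumFrom-cong m (suc n) eq = cong₂ _+_ (eq m ≤-refl (m<m+n m z<s))
  (sumFrom-cong (suc m) n λ j m<j j<1+m+n → eq j (<⇒≤ m<j) (subst (j <_) (sym (+-suc m n)) j<1+m+n))

sumFrom-distrib-+ : ∀ f g m n → sumFrom (λ j → f j + g j) m n ≡ sumFrom f m n + sumFrom g m n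
sumFrom-distrib-+ f g m zero    = refl
sumFrom-distrib-+ f g m (suc n) = trans
  (cong (_+_ (f m + g m)) (sumFrom-distrib-+ f g (suc m) n))
  (+-interchange (f m) (g m) (sumFrom f (suc m) n) (sumFrom g (suc m) n))
  where
  +-interchange : ∀ a b c d → a + b + (c + d) ≡ a + c + (b + d)
  +-interchange = solve-∀

range-split : ∀ f {m n o} → m ≤ n → n ≤ o → range f m o ≡ range f m n + range f n o
range-split f {m} {n} {o} m≤n n≤o = begin
  sumFrom f m (o ∸ m)
    ≡⟨ cong (sumFrom f m) o∸m≡[n∸m]+[o∸n] ⟩
  sumFrom f m ((n ∸ m) + (o ∸ n))
    ≡⟨ sumFrom-+ f m (n ∸ m) (o ∸ n) ⟩
  sumFrom f m (n ∸ m) + sumFrom f (m + (n ∸ m)) (o ∸ n)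
    ≡⟨ cong (λ i → range f m n + sumFrom f i (o ∸ n)) (m+[n∸m]≡n m≤n) ⟩
  range f m n + range f n o
    ∎
  where
  open ≡-Reasoning
  o∸m≡[n∸m]+[o∸n] : o ∸ m ≡ (n ∸ m) + (o ∸ n)
  o∸m≡[n∸m]+[o∸n] = trans (cong (_∸ m) (sym (m+[n∸m]≡n n≤o))) (+-∸-comm (o ∸ n) m≤n)

range-single : ∀ f m → range f m (suc m) ≡ f m
range-single f m = trans (cong (sumFrom f m) (m+n∸n≡m 1 m)) (+-identityʳ (f m))

range-peel : ∀ f {m n} → m < n → range f m n ≡ f m + range f (suc m) n
range-peel f {m} {n} m<n =
  trans (range-split f (n≤1+n m) m<n) (cong (_+ range f (suc m) n) (range-single f m))

range-cong : ∀ {f g m n} → m ≤ n → (∀ j → m ≤ j → j < n → f j ≡ g j) → range f m n ≡ range g m n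
range-cong {m = m} {n} m≤n eq =
  sumFrom-cong m (n ∸ m) λ j m≤j j<m+[n∸m] → eq j m≤j (subst (j <_) (m+[n∸m]≡n m≤n) j<m+[n∸m])

range-≡0 : ∀ {f m n} → m ≤ n → (∀ j → m ≤ j → j < n → f j ≡ 0) → range f m n ≡ 0
range-≡0 {m = m} {n} m≤n eq = trans (range-cong m≤n eq) (sumFrom-0 m (n ∸ m))
  where
  sumFrom-0 : ∀ m c → sumFrom (λ _ → 0) m c ≡ 0
  sumFrom-0 m zero    = refl
  sumFrom-0 m (suc c) = sumFrom-0 (suc m) c

applyUpTo-cong : ∀ {A : Set} {f g : ℕ → A} → (∀ j → f j ≡ g j) → ∀ n → applyUpTo f n ≡ applyUpTo g n
applyUpTo-cong eq zero    = refl
applyUpTo-cong eq (suc n) = cong₂ _∷_ (eq 0) (applyUpTo-cong (eq ∘ suc) n)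

sum-applyUpTo : ∀ f n → sum (applyUpTo f n) ≡ range f 0 n
sum-applyUpTo f zero    = refl
sum-applyUpTo f (suc n) = cong (_+_ (f 0)) (trans (sum-applyUpTo (f ∘ suc) n) (sym (sumFrom-suc f 0 n)))

ext-< : ∀ {k} (r : Fin k → ℕ) {j} (j<k : j < k) → ext r j ≡ r (fromℕ< j<k)
ext-< {k} r {j} j<k with j ℕ.<? k
... | yes j<k′ = cong r (fromℕ<-cong j j refl j<k′ j<k)
... | no  j≮k  = contradiction j<k j≮k

ext-≮ : ∀ {k} (r : Fin k → ℕ) {j} → ¬ j < k → ext r j ≡ 0
ext-≮ {k} r {j} j≮k with j ℕ.<? k
... | yes j<k = contradiction j<k j≮k
... | no  _   = refl

ext-suc : ∀ {k} (r : Fin (suc k) → ℕ) j → ext r (suc j) ≡ ext (r ∘ Fin.suc) j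
ext-suc {k} r j with j ℕ.<? k
... | yes j<k = ext-< r (s≤s j<k)
... | no  j≮k = ext-≮ r (j≮k ∘ ≤-pred)

tabulate≡applyUpTo-ext : ∀ {k} (r : Fin k → ℕ) → tabulate r ≡ applyUpTo (ext r) k
tabulate≡applyUpTo-ext {zero}  r = refl
tabulate≡applyUpTo-ext {suc k} r = cong₂ _∷_ (sym (ext-< r z<s))
  (trans (tabulate≡applyUpTo-ext (r ∘ Fin.suc)) (applyUpTo-cong (sym ∘ ext-suc r) k))

ΣF≡sum-tabulate : ∀ {k} (s : Fin k → ℕ) → ΣF s ≡ sum (tabulate s)
ΣF≡sum-tabulate {zero}  s = refl
ΣF≡sum-tabulate {suc k} s = cong (_+_ (s Fin.zero)) (ΣF≡sum-tabulate (s ∘ Fin.suc))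

-- Coefficient lists and the sumset

infix 4 _≤*_
_≤*_ : List ℕ → List ℕ → Set
_≤*_ = Pointwise _≤_

linComb : List ℤ → List ℕ → ℤ
linComb (a ∷ as) (x ∷ xs) = + x ℤ.* a ℤ.+ linComb as xs
linComb _        _        = + 0

Admissible : List ℕ → ℕ → List ℕ → Set
Admissible rs h c = c ≤* rs × sum c ≡ h

ListSumset : List ℤ → List ℕ → ℕ → ℤ → Set
ListSumset as rs h x = ∃ λ c → Admissible rs h c × x ≡ linComb as c

tabulate-≤* : ∀ {k} {s r : Fin k → ℕ} → (∀ i → s i ≤ r i) → tabulate s ≤* tabulate r
tabulate-≤* {zero}  s≤r = []
tabulate-≤* {suc k} s≤r = s≤r Fin.zero ∷ tabulate-≤* (s≤r ∘ Fin.suc)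

≤*-tabulate⁻ : ∀ {k} (r : Fin k → ℕ) {c} → c ≤* tabulate r →
               ∃ λ (s : Fin k → ℕ) → tabulate s ≡ c × (∀ i → s i ≤ r i)
≤*-tabulate⁻ {zero}  r [] = (λ ()) , refl , λ ()
≤*-tabulate⁻ {suc k} r {x ∷ _} (x≤r₀ ∷ c≤r) with ≤*-tabulate⁻ (r ∘ Fin.suc) c≤r
... | s , refl , s≤r = cons x s , refl , λ { Fin.zero → x≤r₀ ; (Fin.suc i) → s≤r i }

ΣFℤ≡linComb-tabulate : ∀ {k} (a : Fin k → ℤ) (s : Fin k → ℕ) →
                       ΣFℤ (λ i → + s i ℤ.* a i) ≡ linComb (tabulate a) (tabulate s)
ΣFℤ≡linComb-tabulate {zero}  a s = refl
ΣFℤ≡linComb-tabulate {suc k} a s =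
  cong (ℤ._+_ (+ s Fin.zero ℤ.* a Fin.zero)) (ΣFℤ≡linComb-tabulate (a ∘ Fin.suc) (s ∘ Fin.suc))

InSumset⇔ListSumset : ∀ {k} (a : Fin k → ℤ) (r : Fin k → ℕ) h x →
                      InSumset a r h x ⇔ ListSumset (tabulate a) (tabulate r) h x
InSumset⇔ListSumset a r h x = mk⇔ to from
  where
  to : InSumset a r h x → ListSumset (tabulate a) (tabulate r) h x
  to (s , s≤r , Σs≡h , x≡) =
    tabulate s , (tabulate-≤* s≤r , trans (sym (ΣF≡sum-tabulate s)) Σs≡h) , trans x≡ (ΣFℤ≡linComb-tabulate a s)
  from : ListSumset (tabulate a) (tabulate r) h x → InSumset a r h x
  from (c , (c≤r , Σc≡h) , x≡) with ≤*-tabulate⁻ r c≤r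
  ... | s , refl , s≤r = s , s≤r , trans (ΣF≡sum-tabulate s) Σc≡h , trans x≡ (sym (ΣFℤ≡linComb-tabulate a s))

Linked-tabulate : ∀ {k} (a : Fin k → ℤ) → StrictlyIncreasing a → Linked ℤ._<_ (tabulate a)
Linked-tabulate {zero}        a a↑ = []
Linked-tabulate {suc zero}    a a↑ = [-]
Linked-tabulate {suc (suc k)} a a↑ = a↑ Fin.zero (Fin.suc Fin.zero) z<s
  ∷ Linked-tabulate (a ∘ Fin.suc) (λ i j i<j → a↑ (Fin.suc i) (Fin.suc j) (s≤s i<j))

boundedLists : List ℕ → List (List ℕ)
boundedLists []       = [] ∷ []
boundedLists (r ∷ rs) = cartesianProductWith _∷_ (upTo (suc r)) (boundedLists rs)

∈-boundedLists⁺ : ∀ {c rs} → c ≤* rs → c ∈ boundedLists rs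
∈-boundedLists⁺ []            = here refl
∈-boundedLists⁺ (x≤r ∷ c≤rs) = ∈-cartesianProductWith⁺ _∷_ (∈-upTo⁺ (s≤s x≤r)) (∈-boundedLists⁺ c≤rs)

∈-boundedLists⁻ : ∀ {c} rs → c ∈ boundedLists rs → c ≤* rs
∈-boundedLists⁻ []       (here refl) = []
∈-boundedLists⁻ (r ∷ rs) c∈ with ∈-cartesianProductWith⁻ _∷_ (upTo (suc r)) (boundedLists rs) c∈
... | x , c , x∈ , c∈′ , refl = ≤-pred (∈-upTo⁻ x∈) ∷ ∈-boundedLists⁻ rs c∈′

sumsetList : List ℤ → List ℕ → ℕ → List ℤ
sumsetList as rs h = deduplicate ℤ._≟_ (map (linComb as) (filter (λ c → sum c ℕ.≟ h) (boundedLists rs)))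

∈-sumsetList : ∀ as rs h x → x ∈ sumsetList as rs h ⇔ ListSumset as rs h x
∈-sumsetList as rs h x = mk⇔ to from
  where
  to : x ∈ sumsetList as rs h → ListSumset as rs h x
  to x∈ with ∈-map⁻ (linComb as) (∈-deduplicate⁻ ℤ._≟_ _ x∈)
  ... | c , c∈ , refl with ∈-filter⁻ (λ c → sum c ℕ.≟ h) c∈
  ... | c∈′ , Σc≡h = c , (∈-boundedLists⁻ rs c∈′ , Σc≡h) , refl
  from : ListSumset as rs h x → x ∈ sumsetList as rs h
  from (c , (c≤rs , Σc≡h) , refl) = ∈-deduplicate⁺ ℤ._≟_
    (∈-map⁺ (linComb as) (∈-filter⁺ (λ c → sum c ℕ.≟ h) (∈-boundedLists⁺ c≤rs) Σc≡h))

Unique-sumsetList : ∀ as rs h → Unique (sumsetList as rs h)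
Unique-sumsetList as rs h = deduplicate-! ℤ._≟_ _

module _ {A : Set} where

  ∈-─ : ∀ {x z : A} {ys} (x∈ys : x ∈ ys) → z ∈ ys → ¬ z ≡ x → z ∈ (ys ─ x∈ys)
  ∈-─ (here refl) (here refl) z≢x = contradiction refl z≢x
  ∈-─ (here refl) (there z∈) z≢x = z∈
  ∈-─ (there x∈)  (here z≡)  z≢x = here z≡
  ∈-─ (there x∈)  (there z∈) z≢x = there (∈-─ x∈ z∈ z≢x)

  Unique-⊆⇒length-≤ : ∀ {xs ys : List A} → Unique xs → (∀ {z} → z ∈ xs → z ∈ ys) → length xs ≤ length ys
  Unique-⊆⇒length-≤ {[]}     _            _    = z≤n
  Unique-⊆⇒length-≤ {x ∷ xs} {ys} (x∉xs ∷ xs!) xs⊆ys = ≤-trans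
    (s≤s (Unique-⊆⇒length-≤ xs! λ z∈xs → ∈-─ x∈ys (xs⊆ys (there z∈xs)) (All.lookup x∉xs z∈xs ∘ sym)))
    (≤-reflexive (sym (length-removeAt′ ys _)))
    where
    x∈ys = xs⊆ys (here refl)

≤*-sum : ∀ {s rs} → s ≤* rs → sum s ≤ sum rs
≤*-sum []            = z≤n
≤*-sum (x≤r ∷ s≤rs) = +-mono-≤ x≤r (≤*-sum s≤rs)

-- Moves

data Move : List ℕ → List ℕ → List ℕ → Set where
  here  : ∀ {r₀ r₁ rs x y zs} → suc y ≤ r₁ → Move (r₀ ∷ r₁ ∷ rs) (suc x ∷ y ∷ zs) (x ∷ suc y ∷ zs)
  there : ∀ {r rs z xs ys} → Move rs xs ys → Move (r ∷ rs) (z ∷ xs) (z ∷ ys)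

Moves : List ℕ → List ℕ → List ℕ → Set
Moves rs = Star (Move rs)

steps : ∀ {I : Set} {T : Rel I 0ℓ} {x y} → Star T x y → ℕ
steps ε       = 0
steps (_ ◅ p) = suc (steps p)

-- weight (x₀ ∷ x₁ ∷ … ∷ xₙ) = Σᵢ i · xᵢ
weight : List ℕ → ℕ
weight []       = 0
weight (x ∷ xs) = sum xs + weight xs

move-sum : ∀ {rs s t} → Move rs s t → sum t ≡ sum s
move-sum (here {x = x} {y} {zs} _) = +-suc x (y + sum zs)
move-sum (there {z = z} m)          = cong (_+_ z) (move-sum m)

move-weight : ∀ {rs s t} → Move rs s t → weight t ≡ suc (weight s)
move-weight (here _)  = refl
move-weight (there m) = trans (cong₂ _+_ (move-sum m) (move-weight m)) (+-suc _ _)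

move-≤* : ∀ {rs s t} → Move rs s t → s ≤* rs → t ≤* rs
move-≤* (here y<r₁) (s≤s x≤r₀ ∷ _ ∷ zs≤rs) = m≤n⇒m≤1+n x≤r₀ ∷ y<r₁ ∷ zs≤rs
move-≤* (there m)   (z≤r ∷ s≤rs)           = z≤r ∷ move-≤* m s≤rs

moves-weight : ∀ {rs s t} (p : Moves rs s t) → weight t ≡ steps p + weight s
moves-weight ε       = refl
moves-weight (m ◅ p) = trans (moves-weight p) (trans (cong (_+_ (steps p)) (move-weight m)) (+-suc _ _))

packLeft : List ℕ → ℕ → List ℕ
packLeft []       h = []
packLeft (r ∷ rs) h = r ⊓ h ∷ packLeft rs (h ∸ r)

packRight : List ℕ → ℕ → List ℕ
packRight []       h = []
packRight (r ∷ rs) h = r ⊓ (h ∸ sum rs) ∷ packRight rs h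

packLeft-≤* : ∀ rs h → packLeft rs h ≤* rs
packLeft-≤* []       h = []
packLeft-≤* (r ∷ rs) h = m⊓n≤m r h ∷ packLeft-≤* rs (h ∸ r)

packLeft-sum : ∀ rs {h} → h ≤ sum rs → sum (packLeft rs h) ≡ h
packLeft-sum []       h≤0 = sym (n≤0⇒n≡0 h≤0)
packLeft-sum (r ∷ rs) {h} h≤Σ with h ℕ.≤? r
... | yes h≤r rewrite m≥n⇒m⊓n≡n h≤r | m≤n⇒m∸n≡0 h≤r =
  trans (cong (_+_ h) (packLeft-sum rs z≤n)) (+-identityʳ h)
... | no  h≰r rewrite m≤n⇒m⊓n≡m (≰⇒≥ h≰r) =
  trans (cong (_+_ r) (packLeft-sum rs (m≤n+o⇒m∸n≤o h r h≤Σ))) (m+[n∸m]≡n (≰⇒≥ h≰r))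

packRight-full : ∀ rs {h} → sum rs ≤ h → packRight rs h ≡ rs
packRight-full []       _    = refl
packRight-full (r ∷ rs) {h} Σ≤h =
  cong₂ _∷_ (m+o≤n⇒m⊓[n∸o]≡m r h (sum rs) Σ≤h) (packRight-full rs (≤-trans (m≤n+m (sum rs) r) Σ≤h))

packRight-push : ∀ r₀ {rs} h x → All (1 ≤_) rs → h < sum rs →
                 Moves (r₀ ∷ rs) (suc x ∷ packRight rs h) (x ∷ packRight rs (suc h))
-- While the caps after r₁ are not yet full, the unit passes through the empty slot r₁ (here r₁ ≥ 1 is
-- needed); otherwise it stays there.
packRight-push r₀ {r₁ ∷ rs} h x (1≤r₁ ∷ rs⁺) h<Σ with h ℕ.<? sum rs
... | yes h<Σrs rewrite n≤o⇒m⊓[n∸o]≡0 r₁ h (sum rs) (<⇒≤ h<Σrs) | n≤o⇒m⊓[n∸o]≡0 r₁ (suc h) (sum rs) h<Σrs =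
  here 1≤r₁ ◅ gmap (x ∷_) there (packRight-push r₁ h 0 rs⁺ h<Σrs)
... | no  h≮Σrs rewrite packRight-full rs (≮⇒≥ h≮Σrs) | packRight-full rs (≤-trans (≮⇒≥ h≮Σrs) (n≤1+n h))
                      | n≤m+o⇒m⊓[n∸o]≡n∸o r₁ h (sum rs) (<⇒≤ h<Σ) | n≤m+o⇒m⊓[n∸o]≡n∸o r₁ (suc h) (sum rs) h<Σ
                      | +-∸-assoc 1 (≮⇒≥ h≮Σrs) =
  here (subst (h ∸ sum rs <_) (m+n∸n≡m r₁ (sum rs)) (∸-monoˡ-< h<Σ (≮⇒≥ h≮Σrs))) ◅ ε

packRight-pour : ∀ r₀ {rs} d y h → All (1 ≤_) rs → d + h ≤ sum rs →
                 Moves (r₀ ∷ rs) (d + y ∷ packRight rs h) (y ∷ packRight rs (d + h))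
packRight-pour r₀         zero    y h rs⁺ _     = ε
packRight-pour r₀ {rs} (suc d) y h rs⁺ d+h<Σ =
  packRight-push r₀ h (d + y) rs⁺ (≤-trans (s≤s (m≤n+m h d)) d+h<Σ) ◅◅
  subst (λ h′ → Moves (r₀ ∷ rs) (d + y ∷ packRight rs (suc h)) (y ∷ packRight rs h′)) (+-suc d h)
        (packRight-pour r₀ d y (suc h) rs⁺ (subst (_≤ sum rs) (sym (+-suc d h)) d+h<Σ))

moves-to-packRight : ∀ {rs s} → All (1 ≤_) rs → s ≤* rs → Moves rs s (packRight rs (sum s))
moves-to-packRight {[]}              []          []            = ε
moves-to-packRight {r ∷ rs} {x ∷ s} (_ ∷ rs⁺) (x≤r ∷ s≤rs) =
  gmap (x ∷_) there (moves-to-packRight rs⁺ s≤rs) ◅◅ pour-head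
  where
  Σs≤Σrs : sum s ≤ sum rs
  Σs≤Σrs = ≤*-sum s≤rs
  pour-head : Moves (r ∷ rs) (x ∷ packRight rs (sum s)) (packRight (r ∷ rs) (x + sum s))
  pour-head with x + sum s ℕ.≤? sum rs
  ... | yes fits rewrite n≤o⇒m⊓[n∸o]≡0 r (x + sum s) (sum rs) fits =
    subst (λ x′ → Moves (r ∷ rs) (x′ ∷ packRight rs (sum s)) (0 ∷ packRight rs (x + sum s)))
          (+-identityʳ x) (packRight-pour r x 0 (sum s) rs⁺ fits)
  ... | no overflows
    rewrite n≤m+o⇒m⊓[n∸o]≡n∸o r (x + sum s) (sum rs) (+-mono-≤ x≤r Σs≤Σrs) | m+n∸o≡m∸[o∸n] x Σs≤Σrs
          | packRight-full rs (≰⇒≥ overflows) =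
    subst₂ (λ x′ rs′ → Moves (r ∷ rs) (x′ ∷ packRight rs (sum s)) (x ∸ d ∷ rs′))
           (m+[n∸m]≡n d≤x) (trans (cong (packRight rs) (m∸n+n≡m Σs≤Σrs)) (packRight-full rs ≤-refl))
           (packRight-pour r d (x ∸ d) (sum s) rs⁺ (≤-reflexive (m∸n+n≡m Σs≤Σrs)))
    where
    d = sum rs ∸ sum s
    d≤x : d ≤ x
    d≤x = m≤n+o⇒m∸n≤o (sum rs) (sum s) (subst (sum rs ≤_) (+-comm x (sum s)) (≰⇒≥ overflows))

packLeft-push : ∀ r₀ {rs} h x → All (1 ≤_) rs → h < sum rs →
                Moves (r₀ ∷ rs) (suc x ∷ packLeft rs h) (x ∷ packLeft rs (suc h))
packLeft-push r₀ {r₁ ∷ rs} h x (_ ∷ rs⁺) h<Σ with h ℕ.<? r₁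
... | yes h<r₁ rewrite m≥n⇒m⊓n≡n (<⇒≤ h<r₁) | m≤n⇒m∸n≡0 (<⇒≤ h<r₁) | m≥n⇒m⊓n≡n h<r₁ | m≤n⇒m∸n≡0 h<r₁ =
  here h<r₁ ◅ ε
packLeft-push r₀ {suc r₁ ∷ rs} h x (_ ∷ rs⁺) h<Σ | no h≮r₁
  rewrite m≤n⇒m⊓n≡m (≮⇒≥ h≮r₁) | m≤n⇒m⊓n≡m (m≤n⇒m≤1+n (≮⇒≥ h≮r₁)) | +-∸-assoc 1 (≮⇒≥ h≮r₁) =
  gmap (suc x ∷_) there (packLeft-push (suc r₁) (h ∸ suc r₁) r₁ rs⁺ h∸r₁<Σrs) ◅◅ here ≤-refl ◅ ε
  where
  h∸r₁<Σrs : h ∸ suc r₁ < sum rs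
  h∸r₁<Σrs = subst (h ∸ suc r₁ <_) (m+n∸m≡n (suc r₁) (sum rs)) (∸-monoˡ-< h<Σ (≮⇒≥ h≮r₁))

packLeft-pour : ∀ r₀ {rs} d y h → All (1 ≤_) rs → d + h ≤ sum rs →
                Moves (r₀ ∷ rs) (d + y ∷ packLeft rs h) (y ∷ packLeft rs (d + h))
packLeft-pour r₀         zero    y h rs⁺ _     = ε
packLeft-pour r₀ {rs} (suc d) y h rs⁺ d+h<Σ =
  packLeft-push r₀ h (d + y) rs⁺ (≤-trans (s≤s (m≤n+m h d)) d+h<Σ) ◅◅
  subst (λ h′ → Moves (r₀ ∷ rs) (d + y ∷ packLeft rs (suc h)) (y ∷ packLeft rs h′)) (+-suc d h)
        (packLeft-pour r₀ d y (suc h) rs⁺ (subst (_≤ sum rs) (sym (+-suc d h)) d+h<Σ))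

moves-from-packLeft : ∀ {rs s} → All (1 ≤_) rs → s ≤* rs → Moves rs (packLeft rs (sum s)) s
moves-from-packLeft {[]}              []          []            = ε
moves-from-packLeft {r ∷ rs} {x ∷ s} (_ ∷ rs⁺) (x≤r ∷ s≤rs) =
  pour-head ◅◅ gmap (x ∷_) there (moves-from-packLeft rs⁺ s≤rs)
  where
  Σs≤Σrs : sum s ≤ sum rs
  Σs≤Σrs = ≤*-sum s≤rs
  pour-head : Moves (r ∷ rs) (packLeft (r ∷ rs) (x + sum s)) (x ∷ packLeft rs (sum s))
  pour-head with x + sum s ℕ.≤? r
  ... | yes fits rewrite m≥n⇒m⊓n≡n fits | m≤n⇒m∸n≡0 fits =
    subst₂ (λ x′ h′ → Moves (r ∷ rs) (x′ ∷ packLeft rs 0) (x ∷ packLeft rs h′))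
           (+-comm (sum s) x) (+-identityʳ (sum s))
           (packLeft-pour r (sum s) x 0 rs⁺ (subst (_≤ sum rs) (sym (+-identityʳ (sum s))) Σs≤Σrs))
  ... | no overflows
    rewrite m≤n⇒m⊓n≡m (≰⇒≥ overflows) | +-comm x (sum s) | m+n∸o≡m∸[o∸n] (sum s) x≤r =
    subst₂ (λ r′ h′ → Moves (r ∷ rs) (r′ ∷ packLeft rs (sum s ∸ d)) (x ∷ packLeft rs h′))
           (m∸n+n≡m x≤r) (m+[n∸m]≡n d≤Σs)
           (packLeft-pour r d x (sum s ∸ d) rs⁺ (subst (_≤ sum rs) (sym (m+[n∸m]≡n d≤Σs)) Σs≤Σrs))
    where
    d = r ∸ x
    d≤Σs : d ≤ sum s
    d≤Σs = m≤n+o⇒m∸n≤o r x (subst (r ≤_) (+-comm (sum s) x) (≰⇒≥ overflows))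

-- Chains of moves

module _ {I : Set} {T : Rel I 0ℓ} where

  states : ∀ {x y} → Star T x y → List I
  states {x} ε       = x ∷ []
  states {x} (_ ◅ p) = x ∷ states p

  length-states : ∀ {x y} (p : Star T x y) → length (states p) ≡ suc (steps p)
  length-states ε       = refl
  length-states (_ ◅ p) = cong suc (length-states p)

  states-All : ∀ {P : I → Set} → (∀ {x y} → T x y → P x → P y) →
               ∀ {x y} → P x → (p : Star T x y) → All P (states p)
  states-All preserves px ε       = px ∷ []
  states-All preserves px (t ◅ p) = px ∷ states-All preserves (preserves t px) p

  module _ (f : I → ℤ) (f-increasing : ∀ {x y} → T x y → f x ℤ.< f y) where

    states-≥ : ∀ {x y} (p : Star T x y) → All (λ z → f x ℤ.≤ f z) (states p)
    states-≥ ε       = ℤₚ.≤-refl ∷ []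
    states-≥ (t ◅ p) = ℤₚ.≤-refl ∷ All.map (ℤₚ.≤-trans (ℤₚ.<⇒≤ (f-increasing t))) (states-≥ p)

    Unique-map-states : ∀ {x y} (p : Star T x y) → Unique (map f (states p))
    Unique-map-states ε       = [] ∷ []
    Unique-map-states (t ◅ p) =
      Allₚ.map⁺ (All.map (λ fy≤fz fx≡fz → ℤₚ.<-irrefl fx≡fz (ℤₚ.<-≤-trans (f-increasing t) fy≤fz))
                         (states-≥ p))
      ∷ Unique-map-states p

  module _ (w : I → ℕ) (w-step : ∀ {x y} → T x y → w y ≡ suc (w x)) where

    states-cover : ∀ {x y} (p : Star T x y) {n} → w x ≤ n → n ≤ w y → Any (λ z → w z ≡ n) (states p)
    states-cover ε               wx≤n n≤wy = here (≤-antisym wx≤n n≤wy)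
    states-cover {x} (t ◅ p) {n} wx≤n n≤wy with w x ℕ.≟ n
    ... | yes wx≡n = here wx≡n
    ... | no  wx≢n = there (states-cover p (subst (_≤ n) (sym (w-step t)) (≤∧≢⇒< wx≤n wx≢n)) n≤wy)

move-linComb : ∀ {as rs s t} → Linked ℤ._<_ as → length as ≡ length rs → Move rs s t →
               linComb as s ℤ.< linComb as t
move-linComb {_ ∷ []}         {_ ∷ _ ∷ _} _         ()  (here _)
move-linComb {a ∷ b ∷ as} {s = suc x ∷ y ∷ zs} (a<b ∷ _) _ (here _) =
  subst₂ ℤ._<_ (cancel (linComb (a ∷ b ∷ as) (suc x ∷ y ∷ zs)) a)
               (sym (shift (+ x) (+ y) a b (linComb as zs)))
               (ℤₚ.+-monoʳ-< (linComb (a ∷ b ∷ as) (suc x ∷ y ∷ zs) ℤ.- a) a<b)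
  where
  cancel : ∀ v a → v ℤ.- a ℤ.+ a ≡ v
  cancel = ℤ-solve-∀
  shift : ∀ x y a b v → x ℤ.* a ℤ.+ ((+ 1 ℤ.+ y) ℤ.* b ℤ.+ v) ≡ (+ 1 ℤ.+ x) ℤ.* a ℤ.+ (y ℤ.* b ℤ.+ v) ℤ.- a ℤ.+ b
  shift = ℤ-solve-∀
move-linComb {a ∷ as} {_ ∷ _} {z ∷ _} as↑ len (there m) =
  ℤₚ.+-monoʳ-< (+ z ℤ.* a) (move-linComb (Linked.tail as↑) (suc-injective len) m)

move-Admissible : ∀ {rs h s t} → Move rs s t → Admissible rs h s → Admissible rs h t
move-Admissible m (s≤rs , Σs≡h) = move-≤* m s≤rs , trans (move-sum m) Σs≡h

states-ListSumset : ∀ {as rs h s t} → Admissible rs h s → (p : Moves rs s t) →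
                    ∀ {x} → x ∈ map (linComb as) (states p) → ListSumset as rs h x
states-ListSumset {as} s-adm p x∈ with ∈-map⁻ (linComb as) x∈
... | c , c∈ , refl = c , All.lookup (states-All move-Admissible s-adm p) c∈ , refl

module _ {as : List ℤ} {rs : List ℕ} {h : ℕ} (as↑ : Linked ℤ._<_ as) (len : length as ≡ length rs) where

  states-⊆-sumsetList : ∀ {s t} → Admissible rs h s → (p : Moves rs s t) →
                        ∀ {x} → x ∈ map (linComb as) (states p) → x ∈ sumsetList as rs h
  states-⊆-sumsetList s-adm p = Equivalence.from (∈-sumsetList as rs h _) ∘ states-ListSumset {as} s-adm p

  steps<length-sumsetList : ∀ {s t} → Admissible rs h s → (p : Moves rs s t) →
                            suc (steps p) ≤ length (sumsetList as rs h)
  steps<length-sumsetList s-adm p = begin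
    suc (steps p)
      ≡⟨ sym (length-states p) ⟩
    length (states p)
      ≡⟨ sym (length-map (linComb as) (states p)) ⟩
    length (map (linComb as) (states p))
      ≤⟨ Unique-⊆⇒length-≤ (Unique-map-states (linComb as) (move-linComb as↑ len) p) (states-⊆-sumsetList s-adm p) ⟩
    length (sumsetList as rs h)
      ∎
    where open ≤-Reasoning

linComb-tabulate-offset : ∀ {k} m {r : Fin k → ℕ} {c} → c ≤* tabulate r →
                          linComb (tabulate {n = k} (λ i → + (m + toℕ i))) c ≡ + (m * sum c + weight c)
linComb-tabulate-offset {zero}  m []                    = cong +_ (sym (trans (+-identityʳ (m * 0)) (*-zeroʳ m)))
linComb-tabulate-offset {suc k} m {c = x ∷ c} (_ ∷ c≤r) = begin
  + x ℤ.* + (m + 0) ℤ.+ linComb (tabulate {n = k} (λ i → + (m + suc (toℕ i)))) c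
    ≡⟨ cong (λ as → + x ℤ.* + (m + 0) ℤ.+ linComb as c) (tabulate-cong {n = k} (cong +_ ∘ +-suc m ∘ toℕ)) ⟩
  + x ℤ.* + (m + 0) ℤ.+ linComb (tabulate {n = k} (λ i → + (suc m + toℕ i))) c
    ≡⟨ cong₂ ℤ._+_ (sym (ℤₚ.pos-* x (m + 0))) (linComb-tabulate-offset (suc m) c≤r) ⟩
  + (x * (m + 0) + (suc m * sum c + weight c))
    ≡⟨ cong +_ (regroup x m (sum c) (weight c)) ⟩
  + (m * (x + sum c) + (sum c + weight c))
    ∎
  where
  open ≡-Reasoning
  regroup : ∀ x m s w → x * (m + 0) + ((1 + m) * s + w) ≡ m * (x + s) + (s + w)
  regroup = solve-∀

-- The extreme weights and L(r,h)

weight-applyUpTo : ∀ f n → weight (applyUpTo f n) ≡ range (λ j → j * f j) 0 n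
weight-applyUpTo f zero    = refl
weight-applyUpTo f (suc n) = begin
  sum (applyUpTo (f ∘ suc) n) + weight (applyUpTo (f ∘ suc) n)
    ≡⟨ cong₂ _+_ (sum-applyUpTo (f ∘ suc) n) (weight-applyUpTo (f ∘ suc) n) ⟩
  range (f ∘ suc) 0 n + range (λ j → j * f (suc j)) 0 n
    ≡⟨ sym (sumFrom-distrib-+ (f ∘ suc) (λ j → j * f (suc j)) 0 n) ⟩
  range (λ j → suc j * f (suc j)) 0 n
    ≡⟨ sym (sumFrom-suc (λ j → j * f j) 0 n) ⟩
  sumFrom (λ j → j * f j) 1 n
    ∎
  where open ≡-Reasoning

packRight-applyUpTo : ∀ f n h → packRight (applyUpTo f n) h ≡ applyUpTo (λ j → f j ⊓ (h ∸ range f (suc j) n)) n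
packRight-applyUpTo f zero    h = refl
packRight-applyUpTo f (suc n) h = cong₂ _∷_
  (cong (λ t → f 0 ⊓ (h ∸ t)) (trans (sum-applyUpTo (f ∘ suc) n) (sym (sumFrom-suc f 0 n))))
  (trans (packRight-applyUpTo (f ∘ suc) n h)
         (applyUpTo-cong (λ j → cong (λ t → f (suc j) ⊓ (h ∸ t)) (sym (sumFrom-suc f (suc j) (n ∸ suc j)))) n))

packLeft-applyUpTo : ∀ f n h → packLeft (applyUpTo f n) h ≡ applyUpTo (λ j → f j ⊓ (h ∸ range f 0 j)) n
packLeft-applyUpTo f zero    h = refl
packLeft-applyUpTo f (suc n) h = cong (f 0 ⊓ h ∷_)
  (trans (packLeft-applyUpTo (f ∘ suc) n (h ∸ f 0))
         (applyUpTo-cong (λ j → cong (f (suc j) ⊓_)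
           (trans (∸-+-assoc h (f 0) _) (cong (λ t → h ∸ (f 0 + t)) (sym (sumFrom-suc f 0 j))))) n))

pos-∸ : ∀ {m n} → n ≤ m → + m ℤ.- + n ≡ + (m ∸ n)
pos-∸ {m} {n} n≤m = trans (ℤₚ.m-n≡m⊖n m n) (ℤₚ.⊖-≥ n≤m)

pos-pred-* : ∀ m n → (m ≡ 0 → n ≡ 0) → (+ m ℤ.- + 1) ℤ.* + n ≡ + ((m ∸ 1) * n)
pos-pred-* zero    n m≡0⇒n≡0 rewrite m≡0⇒n≡0 refl = ℤₚ.*-zeroʳ (ℤ.- + 1)
pos-pred-* (suc m) n _       = sym (ℤₚ.pos-* m n)

module _ {k : ℕ} (r : Fin k → ℕ) (h : ℕ) where

  P-suc : ∀ j → P r h (suc j) ≡ P r h j + ext r j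
  P-suc j = trans (range-split (ext r) z≤n (n≤1+n j)) (cong (_+_ (P r h j)) (range-single (ext r) j))

  P-mono : ∀ {i j} → i ≤ j → P r h i ≤ P r h j
  P-mono {i} {j} i≤j = subst (P r h i ≤_) (sym (range-split (ext r) z≤n i≤j)) (m≤m+n _ _)

  S-peel : ∀ {j} → j < k → S r h j ≡ ext r j + S r h (suc j)
  S-peel = range-peel (ext r)

  S-anti : ∀ {i j} → i ≤ j → j ≤ k → S r h j ≤ S r h i
  S-anti {i} {j} i≤j j≤k = subst (S r h j ≤_) (sym (range-split (ext r) i≤j j≤k)) (m≤n+m _ _)

  largest-spec : ∀ n → P r h (largest r h n) ≤ h × largest r h n ≤ n ×
                       (∀ m → largest r h n < m → m ≤ n → h < P r h m)
  largest-spec zero = z≤n , z≤n , λ m 0<m m≤0 → contradiction m≤0 (<⇒≱ 0<m)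
  largest-spec (suc n) with P r h (suc n) ℕ.≤? h
  ... | yes P≤h = P≤h , ≤-refl , λ m n<m m≤n → contradiction m≤n (<⇒≱ n<m)
  ... | no  P≰h with largest-spec n
  ... | P≤h , I≤n , above = P≤h , m≤n⇒m≤1+n I≤n , beyond
    where
    beyond : ∀ m → largest r h n < m → m ≤ suc n → h < P r h m
    beyond m I<m m≤1+n with m ℕ.≟ suc n
    ... | yes refl = ≰⇒> P≰h
    ... | no  m≢1+n = above m I<m (≤-pred (≤∧≢⇒< m≤1+n m≢1+n))

  firstS-spec : ∀ f m n → (∀ j → f j ≡ m + j) → m + n ≡ suc k → (∀ j → j < m → h < S r h j) →
                let M = firstS r h (applyUpTo f n) in S r h M ≤ h × M ≤ k × (∀ j → j < M → h < S r h j)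
  firstS-spec f m zero f≗m+ m≡1+k below =
    subst (_≤ h) (sym (cong (sumFrom (ext r) k) (n∸n≡0 k))) z≤n , ≤-refl ,
    λ j j<k → below j (≤-trans j<k (≤-trans (n≤1+n k) (≤-reflexive (trans (sym m≡1+k) (+-identityʳ m)))))
  firstS-spec f m (suc n) f≗m+ m+n≡1+k below with S r h (f 0) ℕ.≤? h
  ... | yes S≤h = S≤h , subst (_≤ k) (sym f0≡m) m≤k , λ j j<f0 → below j (subst (j <_) f0≡m j<f0)
    where
    f0≡m : f 0 ≡ m
    f0≡m = trans (f≗m+ 0) (+-identityʳ m)
    m≤k : m ≤ k
    m≤k = ≤-pred (subst (m <_) m+n≡1+k (m<m+n m (s≤s z≤n)))
  ... | no  S≰h = firstS-spec (f ∘ suc) (suc m) n (λ j → trans (f≗m+ (suc j)) (+-suc m j))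
                              (trans (sym (+-suc m n)) m+n≡1+k) below′
    where
    below′ : ∀ j → j < suc m → h < S r h j
    below′ j j<1+m with j ℕ.≟ m
    ... | yes refl = ≰⇒> (S≰h ∘ subst (λ i → S r h i ≤ h) (sym (trans (f≗m+ 0) (+-identityʳ j))))
    ... | no  j≢m  = below j (≤∧≢⇒< (≤-pred j<1+m) j≢m)

  M′-spec : S r h (M′ r h) ≤ h × M′ r h ≤ k × (∀ j → j < M′ r h → h < S r h j)
  M′-spec = firstS-spec (λ j → j) 0 (suc k) (λ _ → refl) refl (λ _ ())

  weight-packRight : weight (packRight (tabulate r) h) ≡
                     range (jr r h) (M′ r h) k + (M′ r h ∸ 1) * (h ∸ S r h (M′ r h))
  weight-packRight with M′-spec
  ... | SM≤h , M≤k , below = begin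
    weight (packRight (tabulate r) h)   ≡⟨ cong (λ rs → weight (packRight rs h)) (tabulate≡applyUpTo-ext r) ⟩
    weight (packRight (applyUpTo R k) h) ≡⟨ cong weight (packRight-applyUpTo R k h) ⟩
    weight (applyUpTo entry k)          ≡⟨ weight-applyUpTo entry k ⟩
    range g 0 k                         ≡⟨ split (M′ r h) SM≤h M≤k below ⟩
    range (jr r h) (M′ r h) k + (M′ r h ∸ 1) * (h ∸ S r h (M′ r h)) ∎
    where
    open ≡-Reasoning
    R = ext r
    entry g : ℕ → ℕ
    entry j = R j ⊓ (h ∸ S r h (suc j))
    g j = j * entry j
    full-block : ∀ M → S r h M ≤ h → M ≤ k → range g M k ≡ range (jr r h) M k
    full-block M SM≤h M≤k = range-cong M≤k λ j M≤j j<k → cong (j *_)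
      (m+o≤n⇒m⊓[n∸o]≡m (R j) h _ (subst (_≤ h) (S-peel j<k) (≤-trans (S-anti M≤j (<⇒≤ j<k)) SM≤h)))
    split : ∀ M → S r h M ≤ h → M ≤ k → (∀ j → j < M → h < S r h j) →
            range g 0 k ≡ range (jr r h) M k + (M ∸ 1) * (h ∸ S r h M)
    split zero    SM≤h M≤k below = trans (full-block 0 SM≤h M≤k) (sym (+-identityʳ (range (jr r h) 0 k)))
    split (suc m) SM≤h m<k below = begin
      range g 0 k
        ≡⟨ range-split g z≤n (<⇒≤ m<k) ⟩
      range g 0 m + range g m k
        ≡⟨ cong₂ _+_ empty-block (range-peel g m<k) ⟩
      g m + range g (suc m) k
        ≡⟨ cong₂ _+_ (cong (m *_) partial) (full-block (suc m) SM≤h m<k) ⟩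
      m * (h ∸ S r h (suc m)) + range (jr r h) (suc m) k
        ≡⟨ +-comm (m * (h ∸ S r h (suc m))) _ ⟩
      range (jr r h) (suc m) k + m * (h ∸ S r h (suc m))
        ∎
      where
      h<Sm : h < S r h m
      h<Sm = below m ≤-refl
      empty-block : range g 0 m ≡ 0
      empty-block = range-≡0 z≤n λ j _ j<m → trans (cong (j *_)
        (n≤o⇒m⊓[n∸o]≡0 (R j) h _ (<⇒≤ (<-≤-trans h<Sm (S-anti j<m (<⇒≤ m<k)))))) (*-zeroʳ j)
      partial : entry m ≡ h ∸ S r h (suc m)
      partial = n≤m+o⇒m⊓[n∸o]≡n∸o (R m) h _ (subst (h ≤_) (S-peel m<k) (<⇒≤ h<Sm))

  weight-packLeft : h ≤ P r h k →
                    weight (packLeft (tabulate r) h) ≡ range (jr r h) 0 (Ir r h) + Ir r h * (h ∸ P r h (Ir r h))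
  weight-packLeft h≤Pk with largest-spec k
  ... | PI≤h , I≤k , above = begin
    weight (packLeft (tabulate r) h)   ≡⟨ cong (λ rs → weight (packLeft rs h)) (tabulate≡applyUpTo-ext r) ⟩
    weight (packLeft (applyUpTo R k) h) ≡⟨ cong weight (packLeft-applyUpTo R k h) ⟩
    weight (applyUpTo entry k)         ≡⟨ weight-applyUpTo entry k ⟩
    range g 0 k                        ≡⟨ split (Ir r h) PI≤h I≤k above ⟩
    range (jr r h) 0 (Ir r h) + Ir r h * (h ∸ P r h (Ir r h)) ∎
    where
    open ≡-Reasoning
    R = ext r
    entry g : ℕ → ℕ
    entry j = R j ⊓ (h ∸ P r h j)
    g j = j * entry j
    full-block : ∀ I → P r h I ≤ h → range g 0 I ≡ range (jr r h) 0 I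
    full-block I PI≤h = range-cong {n = I} z≤n λ j _ j<I → cong (j *_)
      (m+o≤n⇒m⊓[n∸o]≡m (R j) h _ (subst (_≤ h) (trans (P-suc j) (+-comm _ (R j))) (≤-trans (P-mono j<I) PI≤h)))
    split : ∀ I → P r h I ≤ h → I ≤ k → (∀ m → I < m → m ≤ k → h < P r h m) →
            range g 0 k ≡ range (jr r h) 0 I + I * (h ∸ P r h I)
    split I PI≤h I≤k above with I ℕ.<? k
    ... | yes I<k = begin
      range g 0 k
        ≡⟨ range-split g z≤n I≤k ⟩
      range g 0 I + range g I k
        ≡⟨ cong₂ _+_ (full-block I PI≤h) (range-peel g I<k) ⟩
      range (jr r h) 0 I + (g I + range g (suc I) k)
        ≡⟨ cong (_+_ (range (jr r h) 0 I)) (cong₂ _+_ (cong (I *_) partial) empty-block) ⟩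
      range (jr r h) 0 I + (I * (h ∸ P r h I) + 0)
        ≡⟨ cong (_+_ (range (jr r h) 0 I)) (+-identityʳ (I * (h ∸ P r h I))) ⟩
      range (jr r h) 0 I + I * (h ∸ P r h I)
        ∎
      where
      h<P[1+I] : h < P r h (suc I)
      h<P[1+I] = above (suc I) ≤-refl I<k
      partial : entry I ≡ h ∸ P r h I
      partial = n≤m+o⇒m⊓[n∸o]≡n∸o (R I) h _ (subst (h ≤_) (trans (P-suc I) (+-comm _ (R I))) (<⇒≤ h<P[1+I]))
      empty-block : range g (suc I) k ≡ 0
      empty-block = range-≡0 I<k λ j I<j _ → trans (cong (j *_)
        (n≤o⇒m⊓[n∸o]≡0 (R j) h _ (<⇒≤ (<-≤-trans h<P[1+I] (P-mono I<j))))) (*-zeroʳ j)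
    ... | no I≮k with ≤-antisym I≤k (≮⇒≥ I≮k)
    ... | refl = begin
      range g 0 k
        ≡⟨ full-block k PI≤h ⟩
      range (jr r h) 0 k
        ≡⟨ sym (+-identityʳ (range (jr r h) 0 k)) ⟩
      range (jr r h) 0 k + 0
        ≡⟨ cong (_+_ (range (jr r h) 0 k)) (sym (trans (cong (k *_) (m≤n⇒m∸n≡0 h≤Pk)) (*-zeroʳ k))) ⟩
      range (jr r h) 0 k + k * (h ∸ P r h k)
        ∎

  L≡weight-packRight-packLeft : h ≤ P r h k →
    L r h ≡ + weight (packRight (tabulate r) h) ℤ.- + weight (packLeft (tabulate r) h) ℤ.+ + 1
  L≡weight-packRight-packLeft h≤Pk = begin
    L r h
      ≡⟨ cong₂ (λ u v → + A ℤ.- + B ℤ.+ u ℤ.- v ℤ.+ + 1) Mθ≡X Iδ≡Y ⟩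
    + A ℤ.- + B ℤ.+ + X ℤ.- + Y ℤ.+ + 1
      ≡⟨ regroup (+ A) (+ B) (+ X) (+ Y) ⟩
    + (A + X) ℤ.- + (B + Y) ℤ.+ + 1
      ≡⟨ cong₂ (λ u v → + u ℤ.- + v ℤ.+ + 1) (sym weight-packRight) (sym (weight-packLeft h≤Pk)) ⟩
    + weight (packRight (tabulate r) h) ℤ.- + weight (packLeft (tabulate r) h) ℤ.+ + 1
      ∎
    where
    open ≡-Reasoning
    A = range (jr r h) (M′ r h) k
    X = (M′ r h ∸ 1) * (h ∸ S r h (M′ r h))
    B = range (jr r h) 0 (Ir r h)
    Y = Ir r h * (h ∸ P r h (Ir r h))
    -- M′ = 0 means M_r(h) = −1; then θ_r(h) = 0 because S r h 0 = Σ r ≥ h.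
    Mθ≡X : Mr r h ℤ.* θr r h ≡ + X
    Mθ≡X = trans (cong (Mr r h ℤ.*_) (pos-∸ (proj₁ M′-spec)))
                 (pos-pred-* (M′ r h) _ λ M′≡0 → m≤n⇒m∸n≡0 (subst (λ M → h ≤ S r h M) (sym M′≡0) h≤Pk))
    Iδ≡Y : + Ir r h ℤ.* δr r h ≡ + Y
    Iδ≡Y = trans (cong (+ Ir r h ℤ.*_) (pos-∸ (proj₁ (largest-spec k)))) (sym (ℤₚ.pos-* (Ir r h) _))
    regroup : ∀ a b x y → a ℤ.- b ℤ.+ x ℤ.- y ℤ.+ + 1 ≡ (a ℤ.+ x) ℤ.- (b ℤ.+ y) ℤ.+ + 1
    regroup = ℤ-solve-∀

module _ {rs : List ℕ} (rs⁺ : All (1 ≤_) rs) {h : ℕ} (h≤Σrs : h ≤ sum rs) where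

  packLeft-Admissible : Admissible rs h (packLeft rs h)
  packLeft-Admissible = packLeft-≤* rs h , packLeft-sum rs h≤Σrs

  extremal-moves : Moves rs (packLeft rs h) (packRight rs h)
  extremal-moves = subst (λ h′ → Moves rs (packLeft rs h) (packRight rs h′)) (packLeft-sum rs h≤Σrs)
                         (moves-to-packRight rs⁺ (packLeft-≤* rs h))

  weight-packLeft-≤ : ∀ {c} → Admissible rs h c → weight (packLeft rs h) ≤ weight c
  weight-packLeft-≤ {c} (c≤rs , refl) =
    subst (weight (packLeft rs (sum c)) ≤_) (sym (moves-weight p)) (m≤n+m _ (steps p))
    where p = moves-from-packLeft rs⁺ c≤rs

  weight-≤-packRight : ∀ {c} → Admissible rs h c → weight c ≤ weight (packRight rs h)
  weight-≤-packRight {c} (c≤rs , refl) =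
    subst (weight c ≤_) (sym (moves-weight p)) (m≤n+m _ (steps p))
    where p = moves-to-packRight rs⁺ c≤rs

  ListSumset-⊆-extremal-states : ∀ {as} → (∀ {c} → c ≤* rs → linComb as c ≡ + weight c) →
                                 ∀ {x} → ListSumset as rs h x → x ∈ map (linComb as) (states extremal-moves)
  ListSumset-⊆-extremal-states {as} linComb≡weight (c , c-adm , refl)
    with find (states-cover weight move-weight extremal-moves (weight-packLeft-≤ c-adm) (weight-≤-packRight c-adm))
  ... | z , z∈ , wz≡wc = subst (_∈ map (linComb as) (states extremal-moves)) z≡c (∈-map⁺ (linComb as) z∈)
    where
    z≤rs : z ≤* rs
    z≤rs = proj₁ (All.lookup (states-All move-Admissible packLeft-Admissible extremal-moves) z∈)
    z≡c : linComb as z ≡ linComb as c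
    z≡c = trans (linComb≡weight z≤rs) (trans (cong +_ wz≡wc) (sym (linComb≡weight (proj₁ c-adm))))

module _ {k : ℕ} (r : Fin k → ℕ) (r-pos : ∀ i → 1 ≤ r i) (h : ℕ) (h≤Σr : h ≤ ΣF r) where

  private
    rs = tabulate r
    rs⁺ : All (1 ≤_) rs
    rs⁺ = Allₚ.tabulate⁺ r-pos
    h≤Σrs : h ≤ sum rs
    h≤Σrs = subst (h ≤_) (ΣF≡sum-tabulate r) h≤Σr
    path = extremal-moves rs⁺ h≤Σrs

  L≡1+steps : L r h ≡ + suc (steps path)
  L≡1+steps = begin
    L r h
      ≡⟨ L≡weight-packRight-packLeft r h h≤Pk ⟩
    + weight (packRight rs h) ℤ.- + weight (packLeft rs h) ℤ.+ + 1
      ≡⟨ cong (λ w → + w ℤ.- + weight (packLeft rs h) ℤ.+ + 1) (moves-weight path) ⟩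
    + steps path ℤ.+ + weight (packLeft rs h) ℤ.- + weight (packLeft rs h) ℤ.+ + 1
      ≡⟨ cancel (+ steps path) (+ weight (packLeft rs h)) ⟩
    + suc (steps path)
      ∎
    where
    open ≡-Reasoning
    h≤Pk : h ≤ P r h k
    h≤Pk = subst (h ≤_) (trans (cong sum (tabulate≡applyUpTo-ext r)) (sum-applyUpTo (ext r) k)) h≤Σrs
    cancel : ∀ s w → s ℤ.+ w ℤ.- w ℤ.+ + 1 ≡ + 1 ℤ.+ s
    cancel = ℤ-solve-∀

  lower-bound : (a : Fin k → ℤ) → StrictlyIncreasing a → ∃ λ n → HasCard (InSumset a r h) n × L r h ℤ.≤ + n
  lower-bound a a↑ =
    length list , (list , Unique-sumsetList as rs h , ∈list⇔ , refl) ,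
    subst (ℤ._≤ + length list) (sym L≡1+steps)
          (+≤+ (steps<length-sumsetList (Linked-tabulate a a↑) len (packLeft-Admissible rs⁺ h≤Σrs) path))
    where
    as = tabulate a
    list = sumsetList as rs h
    len : length as ≡ length rs
    len = trans (length-tabulate a) (sym (length-tabulate r))
    ∈list⇔ : ∀ x → x ∈ list ⇔ InSumset a r h x
    ∈list⇔ x = ⇔.trans (∈-sumsetList as rs h x) (⇔.sym (InSumset⇔ListSumset a r h x))

  attained : ∃ λ (a : Fin k → ℤ) → StrictlyIncreasing a × ∃ λ n → HasCard (InSumset a r h) n × + n ≡ L r h
  attained =
    a , (λ i j i<j → ℤ.+<+ i<j) , suc (steps path) ,
    (list , Unique-map-states (linComb as) (move-linComb as↑ len) path , ∈list⇔ ,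
     trans (length-map (linComb as) (states path)) (length-states path)) ,
    sym L≡1+steps
    where
    a : Fin k → ℤ
    a i = + toℕ i
    as = tabulate a
    as↑ = Linked-tabulate a (λ i j i<j → ℤ.+<+ i<j)
    len : length as ≡ length rs
    len = trans (length-tabulate a) (sym (length-tabulate r))
    list = map (linComb as) (states path)
    ∈list⇔ : ∀ x → x ∈ list ⇔ InSumset a r h x
    ∈list⇔ x = ⇔.trans (mk⇔ (states-ListSumset {as} (packLeft-Admissible rs⁺ h≤Σrs) path)
                             (ListSumset-⊆-extremal-states rs⁺ h≤Σrs {as} (linComb-tabulate-offset 0)))
                        (⇔.sym (InSumset⇔ListSumset a r h x))

theorem1 : (k : ℕ) → 1 ℕ.≤ k → (r : Fin k → ℕ) → (∀ i → 1 ℕ.≤ r i) →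
           (h : ℕ) → 2 ℕ.≤ h → h ℕ.≤ ΣF r →
           (((a : Fin k → ℤ) → StrictlyIncreasing a →
               ∃ λ n → HasCard (InSumset a r h) n × L r h ℤ.≤ + n)
           × (∃ λ (a : Fin k → ℤ) → StrictlyIncreasing a ×
               ∃ λ n → HasCard (InSumset a r h) n × + n ≡ L r h))
theorem1 k _ r r-pos h _ h≤Σr = lower-bound r r-pos h h≤Σr , attained r r-pos h h≤Σr
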